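{- Let $G$ be a unicyclic graph of order $n$ which is not isomorphic to the cycle $C_n$. Then $SO(C_n)<SO(G)$.
   Context: All graphs are finite and simple. A unicyclic graph is a connected graph containing exactly one cycle. For a graph $G$ with edge set $E(G)$ and vertex degrees $d_G(v)$, the Sombor index is $SO(G)=\sum_{uv\in E(G)}\sqrt{d_G(u)^2+d_G(v)^2}$. $C_n$ denotes the cycle on $n$ vertices. -}

module Defs where

open import Data.Nat as ℕ using (ℕ; zero; suc; _≡ᵇ_; _<ᵇ_; _%_)
open import Data.Fin using (Fin; toℕ)
open import Data.Bool using (Bool; true; false; _∧_; _∨_; not; if_then_else_)
open import Data.Bool.Properties using (∨-comm)
open import Data.List using (List; []; _∷_; map; concatMap; allFin)
open import Data.Nat.ListAction using (sum)
open import Data.List.Relation.Binary.Pointwise using (Pointwise)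
open import Data.Product using (Σ; _×_; _,_; ∃-syntax)
open import Data.Sum using (_⊎_)
open import Data.Integer using (+_)
open import Data.Rational as ℚ using (ℚ; 0ℚ)
open import Data.Fin.Permutation using (Permutation; _⟨$⟩ʳ_)
open import Relation.Binary.PropositionalEquality using (_≡_; refl; cong₂)

record Graph (n : ℕ) : Set where
  field
    adj    : Fin n → Fin n → Bool
    sym    : ∀ i j → adj i j ≡ adj j i
    irrefl : ∀ i → adj i i ≡ false
open Graph public

degreeOf : ∀ {n} → (Fin n → Fin n → Bool) → Fin n → ℕ
degreeOf {n} A i = sum (map (λ j → if A i j then 1 else 0) (allFin n))

deg : ∀ {n} → Graph n → Fin n → ℕ
deg G = degreeOf (adj G)

edges : ∀ {n} → Graph n → List (Fin n × Fin n)
edges {n} G = concatMap (λ i → concatMap (λ j →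
  if adj G i j ∧ (toℕ i <ᵇ toℕ j) then (i , j) ∷ [] else []) (allFin n)) (allFin n)

-- the list of radicands  d(u)^2 + d(v)^2, one per edge uv;
-- SO(G) is the sum of their square roots
soTerms : ∀ {n} → Graph n → List ℕ
soTerms G = map (λ e → let (u , v) = e in
  deg G u ℕ.* deg G u ℕ.+ deg G v ℕ.* deg G v) (edges G)

-- Strict comparison of sums of square roots of naturals, without reals:
-- Σ √aₖ < Σ √bₖ  iff there are rational upper bounds uₖ ≥ √aₖ and
-- rational lower bounds lₖ ≤ √bₖ (all nonnegative) with Σ uₖ < Σ lₖ.

ℚ[_] : ℕ → ℚ
ℚ[ a ] = (+ a) ℚ./ 1

IsUpperSqrt : ℚ → ℕ → Set
IsUpperSqrt u a = (0ℚ ℚ.≤ u) × (ℚ[ a ] ℚ.≤ u ℚ.* u)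

IsLowerSqrt : ℚ → ℕ → Set
IsLowerSqrt l a = (0ℚ ℚ.≤ l) × (l ℚ.* l ℚ.≤ ℚ[ a ])

sumℚ : List ℚ → ℚ
sumℚ []       = 0ℚ
sumℚ (x ∷ xs) = x ℚ.+ sumℚ xs

SqrtSumLt : List ℕ → List ℕ → Set
SqrtSumLt as bs = ∃[ us ] ∃[ ls ]
  (Pointwise IsUpperSqrt us as × Pointwise IsLowerSqrt ls bs × (sumℚ us ℚ.< sumℚ ls))

SOLt : ∀ {m n} → Graph m → Graph n → Set
SOLt G H = SqrtSumLt (soTerms G) (soTerms H)

data Walk {n} (A : Fin n → Fin n → Bool) : Fin n → Fin n → Set where
  here : ∀ {i} → Walk A i i
  step : ∀ {i j k} → A i j ≡ true → Walk A j k → Walk A i k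

Connected : ∀ {n} → Graph n → Set
Connected {n} G = ∀ (i j : Fin n) → Walk (adj G) i j

-- A cycle of G, given by its (symmetric) edge indicator S: a nonempty
-- subgraph of G in which every vertex has degree 0 or 2 and whose
-- vertices of degree 2 are mutually connected (i.e. a connected
-- 2-regular subgraph).
record IsCycle {n} (G : Graph n) (S : Fin n → Fin n → Bool) : Set where
  field
    symS      : ∀ i j → S i j ≡ S j i
    sub       : ∀ i j → S i j ≡ true → adj G i j ≡ true
    nonempty  : ∃[ i ] ∃[ j ] (S i j ≡ true)
    deg02     : ∀ i → (degreeOf S i ≡ 0) ⊎ (degreeOf S i ≡ 2)
    connected : ∀ i j → degreeOf S i ≡ 2 → degreeOf S j ≡ 2 → Walk S i j

Unicyclic : ∀ {n} → Graph n → Set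
Unicyclic {n} G = Connected G
  × (∃[ S ] IsCycle G S)
  × (∀ S S' → IsCycle G S → IsCycle G S' → ∀ (i j : Fin n) → S i j ≡ S' i j)

Isomorphic : ∀ {n} → Graph n → Graph n → Set
Isomorphic {n} G H = Σ (Permutation n n) λ π → ∀ (i j : Fin n) →
  adj G i j ≡ adj H (π ⟨$⟩ʳ i) (π ⟨$⟩ʳ j)

-- The cycle C_n on Fin n: i ~ j iff i ≠ j and j ≡ i+1 (mod n) or
-- i ≡ j+1 (mod n).  (For n ≥ 3 this is exactly C_n.)

≡ᵇ-sym : ∀ a b → (a ≡ᵇ b) ≡ (b ≡ᵇ a)
≡ᵇ-sym zero zero = refl
≡ᵇ-sym zero (suc b) = refl
≡ᵇ-sym (suc a) zero = refl
≡ᵇ-sym (suc a) (suc b) = ≡ᵇ-sym a b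

≡ᵇ-refl : ∀ a → (a ≡ᵇ a) ≡ true
≡ᵇ-refl zero = refl
≡ᵇ-refl (suc a) = ≡ᵇ-refl a

succMod : ∀ {n} → Fin n → ℕ
succMod {suc m} i = suc (toℕ i) % suc m

cycleAdj : ∀ {n} → Fin n → Fin n → Bool
cycleAdj i j = not (toℕ i ≡ᵇ toℕ j)
  ∧ ((toℕ j ≡ᵇ succMod i) ∨ (toℕ i ≡ᵇ succMod j))

cycleGraph : (n : ℕ) → Graph n
cycleGraph n = record { adj = cycleAdj ; sym = s ; irrefl = r }
  where
  s : ∀ i j → cycleAdj i j ≡ cycleAdj j i
  s i j = cong₂ _∧_ (Relation.Binary.PropositionalEquality.cong not (≡ᵇ-sym (toℕ i) (toℕ j)))
                    (∨-comm (toℕ j ≡ᵇ succMod i) (toℕ i ≡ᵇ succMod j))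
  r : ∀ i → cycleAdj i i ≡ false
  r i rewrite ≡ᵇ-refl (toℕ i) = refl

-- A connected graph that contains a cycle has at least n edges: besides the
-- cycle edges, every vertex off the cycle has an edge to a neighbour closer to
-- the cycle.  Hence Σ d(v) ≥ 2n.  A connected 2-regular graph is C_n, so G has
-- a vertex of degree ≠ 2, and since d² + 4 ≥ 4d with equality only at d = 2,
-- the first Zagreb index M₁(G) = Σ d(v)² exceeds 4n.  Every edge satisfies
-- √(d(u)² + d(v)²) ≥ (d(u) + d(v))/√2, and Σ_{uv} (d(u) + d(v)) = M₁(G), so
-- SO(G) ≥ M₁(G)/√2 > 2√2 n = SO(C_n).  To stay within ℚ, √2 is replaced by
-- p/q with p² = 2q² + 1 (a Pell solution), q > 2n being close enough.

module Submission where

open import Data.Bool using (Bool; true; false; _∧_; _∨_; not; if_then_else_; T)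
open import Data.Bool.Properties using (∧-identityʳ; ∧-zeroʳ; not-injective; ⇔→≡)
open import Data.Empty using (⊥; ⊥-elim)
open import Data.Fin as Fin using (Fin; toℕ)
import Data.Fin.Properties as Finₚ
open import Data.Fin.Permutation using (permutation)
import Data.Integer as ℤ
import Data.Integer.Properties as ℤₚ
open import Data.List using (List; []; _∷_; _++_; map; concatMap; tabulate; allFin)
import Data.List.Properties as Listₚ
import Data.List.Relation.Binary.Pointwise as Pointwise
open import Data.Nat as ℕ using (ℕ; zero; suc; _+_; _*_; _≤_; _<_; z≤n; s≤s; z<s; _<ᵇ_; _≡ᵇ_; _%_)
open import Data.Nat.Coprimality as Coprime using (1-coprimeTo)
open import Data.Nat.DivMod using (n%n≡0; m<n⇒m%n≡m)
open import Data.Nat.ListAction using () renaming (sum to listSum)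
import Data.Nat.ListAction.Properties as ListSum
open import Data.Nat.Properties
open import Data.Nat.Solver using (module +-*-Solver)
open import Data.Product using (_×_; _,_; proj₁; proj₂; ∃-syntax)
open import Data.Rational as ℚ using (ℚ; mkℚ; 0ℚ; 1ℚ; 1/_)
import Data.Rational.Properties as ℚₚ
open import Data.Rational.Solver using () renaming (module +-*-Solver to ℚ-Solver)
open import Data.Sum using (_⊎_; inj₁; inj₂)
open import Defs hiding (sym)
open import Function using (_∘_; id; case_of_)
open import Function.Bundles using (mk⇔)
open import Relation.Binary.Definitions using (tri<; tri≈; tri>)
open import Relation.Binary.PropositionalEquality
open import Relation.Nullary using (¬_; yes; no)
open import Relation.Nullary.Decidable using (dec-true; dec-false)
open import Algebra.Properties.Semiring.Sum +-*-semiring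
  using (sum-syntax; sum-cong-≗; sum-replicate-zero; ∑-distrib-+; ∑-comm; *-distribˡ-sum)
  renaming (sum to ∑)

𝟙 : Bool → ℕ
𝟙 b = if b then 1 else 0

infix 4 _==_
_==_ : ∀ {n} → Fin n → Fin n → Bool
Fin.zero  == Fin.zero  = true
Fin.zero  == Fin.suc _ = false
Fin.suc _ == Fin.zero  = false
Fin.suc i == Fin.suc j = i == j

==⇒≡ : ∀ {n} (i j : Fin n) → (i == j) ≡ true → i ≡ j
==⇒≡ Fin.zero    Fin.zero    _  = refl
==⇒≡ (Fin.suc i) (Fin.suc j) eq = cong Fin.suc (==⇒≡ i j eq)

==-refl : ∀ {n} (i : Fin n) → (i == i) ≡ true
==-refl Fin.zero    = refl
==-refl (Fin.suc i) = ==-refl i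

≡ᵇ-toℕ : ∀ {n} (i j : Fin n) → (toℕ i ≡ᵇ toℕ j) ≡ (i == j)
≡ᵇ-toℕ Fin.zero    Fin.zero    = refl
≡ᵇ-toℕ Fin.zero    (Fin.suc _) = refl
≡ᵇ-toℕ (Fin.suc _) Fin.zero    = refl
≡ᵇ-toℕ (Fin.suc i) (Fin.suc j) = ≡ᵇ-toℕ i j

≢⇒==-false : ∀ {n} {i j : Fin n} → i ≢ j → (i == j) ≡ false
≢⇒==-false {i = i} {j} i≢j with i == j in eq
... | false = refl
... | true  = ⊥-elim (i≢j (==⇒≡ i j eq))

∨-introʳ : ∀ x {y} → y ≡ true → (x ∨ y) ≡ true
∨-introʳ true  _      = refl
∨-introʳ false y≡true = y≡true

∧-true : ∀ x {y} → (x ∧ y) ≡ true → x ≡ true × y ≡ true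
∧-true true refl = refl , refl

anyFin : ∀ {n} → (Fin n → Bool) → Bool
anyFin {zero}  P = false
anyFin {suc n} P = P Fin.zero ∨ anyFin (P ∘ Fin.suc)

anyFin-intro : ∀ {n} (P : Fin n → Bool) {u} → P u ≡ true → anyFin P ≡ true
anyFin-intro P {Fin.zero}  Pu rewrite Pu = refl
anyFin-intro P {Fin.suc u} Pu with P Fin.zero
... | true  = refl
... | false = anyFin-intro (P ∘ Fin.suc) Pu

anyFin-witness : ∀ {n} (P : Fin n → Bool) → anyFin P ≡ true → ∃[ u ] P u ≡ true
anyFin-witness {suc n} P any with P Fin.zero in P0
... | true  = Fin.zero , P0
... | false = let u , Pu = anyFin-witness (P ∘ Fin.suc) any in Fin.suc u , Pu

least-true : (P : ℕ → Bool) → ∀ {k} → P k ≡ true → ∃[ m ] P m ≡ true × (∀ {j} → P j ≡ true → m ≤ j)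
least-true P {k} Pk with P 0 in P0
... | true = 0 , P0 , λ _ → z≤n
... | false with k
...   | zero with () ← trans (sym P0) Pk
...   | suc k′ with least-true (P ∘ suc) Pk
...     | m , Pm , least = suc m , Pm , λ {j} → above j
  where
  above : ∀ j → P j ≡ true → suc m ≤ j
  above zero    Pj with () ← trans (sym P0) Pj
  above (suc j) Pj = s≤s (least Pj)

𝟙-exclusive-≤ : ∀ {a b c x} →
  (a ≡ true → x ≡ true) → (b ≡ true → x ≡ true) → (c ≡ true → x ≡ true) →
  (a ≡ true → b ≡ true → ⊥) → (a ≡ true → c ≡ true → ⊥) → (b ≡ true → c ≡ true → ⊥) →
  𝟙 a + 𝟙 b + 𝟙 c ≤ 𝟙 x
𝟙-exclusive-≤ {true}  {true}            _  _  _  ab _  _  = ⊥-elim (ab refl refl)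
𝟙-exclusive-≤ {true}  {false} {true}    _  _  _  _  ac _  = ⊥-elim (ac refl refl)
𝟙-exclusive-≤ {false} {true}  {true}    _  _  _  _  _  bc = ⊥-elim (bc refl refl)
𝟙-exclusive-≤ {true}  {false} {false}   ax _  _  _  _  _  rewrite ax refl = ≤-refl
𝟙-exclusive-≤ {false} {true}  {false}   _  bx _  _  _  _  rewrite bx refl = ≤-refl
𝟙-exclusive-≤ {false} {false} {true}    _  _  cx _  _  _  rewrite cx refl = ≤-refl
𝟙-exclusive-≤ {false} {false} {false}   _  _  _  _  _  _  = z≤n

∑-const : ∀ n c → ∑[ i < n ] c ≡ n * c
∑-const zero    c = refl
∑-const (suc n) c = cong (c +_) (∑-const n c)

∑-distrib-+₃ : ∀ {n} (f g h : Fin n → ℕ) → ∑[ i < n ] (f i + g i + h i) ≡ ∑ f + ∑ g + ∑ h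
∑-distrib-+₃ f g h = trans (∑-distrib-+ (λ i → f i + g i) h) (cong (_+ ∑ h) (∑-distrib-+ f g))

∑-mono-≤ : ∀ {n} {f g : Fin n → ℕ} → (∀ i → f i ≤ g i) → ∑ f ≤ ∑ g
∑-mono-≤ {zero}  le = z≤n
∑-mono-≤ {suc n} le = +-mono-≤ (le Fin.zero) (∑-mono-≤ (le ∘ Fin.suc))

∑-mono-< : ∀ {n} {f g : Fin n → ℕ} → (∀ i → f i ≤ g i) → ∀ j → f j < g j → ∑ f < ∑ g
∑-mono-< le Fin.zero    lt = +-mono-<-≤ lt (∑-mono-≤ (le ∘ Fin.suc))
∑-mono-< le (Fin.suc j) lt = +-mono-≤-< (le Fin.zero) (∑-mono-< (le ∘ Fin.suc) j lt)

term≤∑ : ∀ {n} (f : Fin n → ℕ) j → f j ≤ ∑ f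
term≤∑ f Fin.zero    = m≤m+n (f Fin.zero) _
term≤∑ f (Fin.suc j) = ≤-trans (term≤∑ (f ∘ Fin.suc) j) (m≤n+m _ (f Fin.zero))

∑-𝟙-== : ∀ {n} (a : Fin n) → ∑[ j < n ] 𝟙 (j == a) ≡ 1
∑-𝟙-== {suc n} Fin.zero    = cong suc (sum-replicate-zero n)
∑-𝟙-== {suc n} (Fin.suc a) = ∑-𝟙-== a

∑-if : ∀ {n} (P : Fin n → Bool) x → ∑[ j < n ] (if P j then x else 0) ≡ x * ∑[ j < n ] 𝟙 (P j)
∑-if P x = trans (sum-cong-≗ (λ j → if-0 (P j))) (sym (*-distribˡ-sum x (𝟙 ∘ P)))
  where
  if-0 : ∀ b → (if b then x else 0) ≡ x * 𝟙 b
  if-0 true  = sym (*-identityʳ x)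
  if-0 false = sym (*-zeroʳ x)

∑-𝟙-witness : ∀ {n} (P : Fin n → Bool) → 1 ≤ ∑[ j < n ] 𝟙 (P j) → ∃[ j ] P j ≡ true
∑-𝟙-witness {suc n} P pos with P Fin.zero in eq
... | true  = Fin.zero , eq
... | false = let j , Pj = ∑-𝟙-witness (P ∘ Fin.suc) pos in Fin.suc j , Pj

∑-𝟙-two-witnesses : ∀ {n} (P : Fin n → Bool) → 2 ≤ ∑[ j < n ] 𝟙 (P j) →
                    ∃[ a ] ∃[ b ] a ≢ b × P a ≡ true × P b ≡ true
∑-𝟙-two-witnesses {suc n} P two with P Fin.zero in eq
... | true  = let b , Pb = ∑-𝟙-witness (P ∘ Fin.suc) (ℕ.s≤s⁻¹ two) in
              Fin.zero , Fin.suc b , (λ ()) , eq , Pb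
... | false = let a , b , a≢b , Pa , Pb = ∑-𝟙-two-witnesses (P ∘ Fin.suc) two in
              Fin.suc a , Fin.suc b , a≢b ∘ Finₚ.suc-injective , Pa , Pb

listSum-map-allFin : ∀ {n} (f : Fin n → ℕ) → listSum (map f (allFin n)) ≡ ∑ f
listSum-map-allFin f = trans (cong listSum (Listₚ.map-tabulate id f)) (listSum-tabulate f)
  where
  listSum-tabulate : ∀ {n} (f : Fin n → ℕ) → listSum (tabulate f) ≡ ∑ f
  listSum-tabulate {zero}  f = refl
  listSum-tabulate {suc n} f = cong (f Fin.zero +_) (listSum-tabulate (f ∘ Fin.suc))

listSum-concatMap : ∀ {A B : Set} (h : B → ℕ) (f : A → List B) xs →
                    listSum (map h (concatMap f xs)) ≡ listSum (map (listSum ∘ map h ∘ f) xs)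
listSum-concatMap h f []       = refl
listSum-concatMap h f (x ∷ xs) = begin
  listSum (map h (f x ++ concatMap f xs))            ≡⟨ cong listSum (Listₚ.map-++ h (f x) _) ⟩
  listSum (map h (f x) ++ map h (concatMap f xs))    ≡⟨ ListSum.sum-++ (map h (f x)) _ ⟩
  listSum (map h (f x)) + listSum (map h (concatMap f xs))
    ≡⟨ cong (listSum (map h (f x)) +_) (listSum-concatMap h f xs) ⟩
  listSum (map (listSum ∘ map h ∘ f) (x ∷ xs))       ∎
  where open ≡-Reasoning

listSum-map-* : ∀ {X : Set} c (f : X → ℕ) xs → listSum (map (λ x → c * f x) xs) ≡ c * listSum (map f xs)
listSum-map-* c f []       = sym (*-zeroʳ c)
listSum-map-* c f (x ∷ xs) = trans (cong (c * f x +_) (listSum-map-* c f xs)) (sym (*-distribˡ-+ c (f x) _))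

-- Finite pigeonhole arguments

three-distinct⇒3≤n : ∀ {n} {a b c : Fin n} → a ≢ b → a ≢ c → b ≢ c → 3 ≤ n
three-distinct⇒3≤n {suc (suc (suc _))} _ _ _ = s≤s (s≤s (s≤s z≤n))
three-distinct⇒3≤n {1} {Fin.zero        } {Fin.zero        }                    a≢b _   _   = ⊥-elim (a≢b refl)
three-distinct⇒3≤n {2} {Fin.zero        } {Fin.zero        }                    a≢b _   _   = ⊥-elim (a≢b refl)
three-distinct⇒3≤n {2} {Fin.suc Fin.zero} {Fin.suc Fin.zero}                    a≢b _   _   = ⊥-elim (a≢b refl)
three-distinct⇒3≤n {2} {Fin.zero        } {Fin.suc Fin.zero} {Fin.zero}         _   a≢c _   = ⊥-elim (a≢c refl)
three-distinct⇒3≤n {2} {Fin.suc Fin.zero} {Fin.zero        } {Fin.suc Fin.zero} _   a≢c _   = ⊥-elim (a≢c refl)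
three-distinct⇒3≤n {2} {Fin.zero        } {Fin.suc Fin.zero} {Fin.suc Fin.zero} _   _   b≢c = ⊥-elim (b≢c refl)
three-distinct⇒3≤n {2} {Fin.suc Fin.zero} {Fin.zero        } {Fin.zero}         _   _   b≢c = ⊥-elim (b≢c refl)

record FirstRepeat {n} (f : ℕ → Fin n) : Set where
  field
    i j             : ℕ
    i<j             : i < j
    j≤n             : j ≤ n
    repeat          : f i ≡ f j
    injective-below : ∀ {a b} → a < b → b < j → f a ≢ f b

module _ {n} (f : ℕ → Fin n) where

  private
    seen : ℕ → Bool
    seen k = anyFin {k} (λ i → f (toℕ i) == f k)

    seen-intro : ∀ {a b} → a < b → f a ≡ f b → seen b ≡ true
    seen-intro {a} {b} a<b f[a]≡f[b] = anyFin-intro _ {Fin.fromℕ< a<b}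
      (trans (cong (λ k → f k == f b) (Finₚ.toℕ-fromℕ< a<b)) (trans (cong (_== f b) f[a]≡f[b]) (==-refl (f b))))

  -- Only the specification of first-repeat is ever needed; unfolding the
  -- search during type checking is prohibitively expensive.
  opaque
    first-repeat : FirstRepeat f
    first-repeat with Finₚ.pigeonhole (n<1+n n) (f ∘ toℕ)
    ... | a , b , a<b , f[a]≡f[b] with least-true seen {toℕ b} (seen-intro a<b f[a]≡f[b])
    ...   | j , seen-j , minimal with anyFin-witness _ seen-j
    ...     | i , f[i]==f[j] = record
      { i = toℕ i ; j = j ; i<j = Finₚ.toℕ<n i
      ; j≤n = ≤-trans (minimal (seen-intro a<b f[a]≡f[b])) (ℕ.s≤s⁻¹ (Finₚ.toℕ<n b))
      ; repeat = ==⇒≡ (f (toℕ i)) (f j) f[i]==f[j]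
      ; injective-below = λ a<b b<j f[a]≡f[b] → <⇒≱ b<j (minimal (seen-intro a<b f[a]≡f[b])) }

-- Graphs, degrees and edge sums

degreeOf-∑ : ∀ {n} (A : Fin n → Fin n → Bool) i → degreeOf A i ≡ ∑[ j < n ] 𝟙 (A i j)
degreeOf-∑ A i = listSum-map-allFin (𝟙 ∘ A i)

module _ {n} (G : Graph n) where

  adj⇒≢ : ∀ {x y} → adj G x y ≡ true → x ≢ y
  adj⇒≢ {x} xy refl with () ← trans (sym xy) (Graph.irrefl G x)

  adj-sym : ∀ {x y} → adj G x y ≡ true → adj G y x ≡ true
  adj-sym {x} {y} xy = trans (Graph.sym G y x) xy

  edgeSum : (Fin n × Fin n → ℕ) → ℕ
  edgeSum h = listSum (map h (edges G))

  zagreb₁ : ℕ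
  zagreb₁ = ∑[ i < n ] (deg G i * deg G i)

  adjacentSum : (Fin n × Fin n → ℕ) → ℕ
  adjacentSum h = ∑[ i < n ] ∑[ j < n ] (if adj G i j then h (i , j) else 0)

  module _ (h : Fin n × Fin n → ℕ) where

    private
      forward : Fin n → Fin n → ℕ
      forward i j = if adj G i j ∧ (toℕ i <ᵇ toℕ j) then h (i , j) else 0

    edgeSum-∑ : edgeSum h ≡ ∑[ i < n ] ∑[ j < n ] forward i j
    edgeSum-∑ = begin
      listSum (map h (edges G))
        ≡⟨ listSum-concatMap h _ (allFin n) ⟩
      listSum (map (λ i → listSum (map h (concatMap (singleton i) (allFin n)))) (allFin n))
        ≡⟨ listSum-map-allFin (λ i → listSum (map h (concatMap (singleton i) (allFin n)))) ⟩
      ∑[ i < n ] listSum (map h (concatMap (singleton i) (allFin n)))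
        ≡⟨ sum-cong-≗ (λ i → trans (listSum-concatMap h (singleton i) (allFin n))
                                   (trans (listSum-map-allFin (listSum ∘ map h ∘ singleton i))
                                          (sum-cong-≗ (singleton-sum i)))) ⟩
      ∑[ i < n ] ∑[ j < n ] forward i j ∎
      where
      open ≡-Reasoning
      singleton : Fin n → Fin n → List (Fin n × Fin n)
      singleton i j = if adj G i j ∧ (toℕ i <ᵇ toℕ j) then (i , j) ∷ [] else []
      singleton-sum : ∀ i j → listSum (map h (singleton i j)) ≡ forward i j
      singleton-sum i j with adj G i j ∧ (toℕ i <ᵇ toℕ j)
      ... | true  = +-identityʳ (h (i , j))
      ... | false = refl

    handshake : (∀ i j → h (i , j) ≡ h (j , i)) → 2 * edgeSum h ≡ adjacentSum h
    handshake h-sym = begin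
      2 * edgeSum h
        ≡⟨ cong (edgeSum h +_) (+-identityʳ (edgeSum h)) ⟩
      edgeSum h + edgeSum h
        ≡⟨ cong₂ _+_ edgeSum-∑ (trans edgeSum-∑ (∑-comm forward)) ⟩
      ∑[ i < n ] ∑[ j < n ] forward i j + ∑[ i < n ] ∑[ j < n ] forward j i
        ≡⟨ sym (∑-distrib-+ (λ i → ∑[ j < n ] forward i j) (λ i → ∑[ j < n ] forward j i)) ⟩
      ∑[ i < n ] (∑[ j < n ] forward i j + ∑[ j < n ] forward j i)
        ≡⟨ sum-cong-≗ (λ i → sym (∑-distrib-+ (forward i) (λ j → forward j i))) ⟩
      ∑[ i < n ] ∑[ j < n ] (forward i j + forward j i)
        ≡⟨ sum-cong-≗ (λ i → sum-cong-≗ (λ j → sym (split i j))) ⟩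
      adjacentSum h ∎
      where
      open ≡-Reasoning
      split : ∀ i j → (if adj G i j then h (i , j) else 0) ≡ forward i j + forward j i
      split i j with <-cmp (toℕ i) (toℕ j)
      ... | tri< i<j _ j≮i
        rewrite dec-true (toℕ i ℕ.<? toℕ j) i<j | dec-false (toℕ j ℕ.<? toℕ i) j≮i
              | ∧-identityʳ (adj G i j) | ∧-zeroʳ (adj G j i) = sym (+-identityʳ _)
      ... | tri> i≮j _ j<i
        rewrite dec-true (toℕ j ℕ.<? toℕ i) j<i | dec-false (toℕ i ℕ.<? toℕ j) i≮j
              | ∧-identityʳ (adj G j i) | ∧-zeroʳ (adj G i j) | Graph.sym G j i | h-sym j i = refl
      ... | tri≈ _ i≡j _ with Finₚ.toℕ-injective i≡j
      ...   | refl rewrite Graph.irrefl G i = refl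

  adjacentSum-const : ∀ c → adjacentSum (λ _ → c) ≡ c * ∑[ i < n ] deg G i
  adjacentSum-const c = begin
    ∑[ i < n ] ∑[ j < n ] (if adj G i j then c else 0)  ≡⟨ sum-cong-≗ (λ i → ∑-if (adj G i) c) ⟩
    ∑[ i < n ] (c * ∑[ j < n ] 𝟙 (adj G i j)) ≡⟨ sym (*-distribˡ-sum c (λ i → ∑[ j < n ] 𝟙 (adj G i j))) ⟩
    c * ∑[ i < n ] ∑[ j < n ] 𝟙 (adj G i j)             ≡⟨ cong (c *_) (sum-cong-≗ (sym ∘ degreeOf-∑ (adj G))) ⟩
    c * ∑[ i < n ] deg G i                              ∎
    where open ≡-Reasoning

  edgeSum-const-2-regular : (∀ i → deg G i ≡ 2) → ∀ c → edgeSum (λ _ → c) ≡ n * c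
  edgeSum-const-2-regular regular c = *-cancelˡ-≡ _ _ 2 (begin
    2 * edgeSum (λ _ → c)        ≡⟨ handshake (λ _ → c) (λ _ _ → refl) ⟩
    adjacentSum (λ _ → c)        ≡⟨ adjacentSum-const c ⟩
    c * ∑[ i < n ] deg G i       ≡⟨ cong (c *_) (trans (sum-cong-≗ regular) (∑-const n 2)) ⟩
    c * (n * 2)                  ≡⟨ solve 2 (λ c n → c :* (n :* con 2) := con 2 :* (n :* c)) refl c n ⟩
    2 * (n * c)                  ∎)
    where
    open ≡-Reasoning
    open +-*-Solver

  edgeSum-deg+deg : edgeSum (λ e → deg G (proj₁ e) + deg G (proj₂ e)) ≡ zagreb₁

  edgeSum-deg+deg = *-cancelˡ-≡ _ _ 2 (begin
    2 * edgeSum (λ e → d (proj₁ e) + d (proj₂ e))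
      ≡⟨ handshake (λ e → d (proj₁ e) + d (proj₂ e)) (λ i j → +-comm (d i) (d j)) ⟩
    ∑[ i < n ] ∑[ j < n ] (if adj G i j then d i + d j else 0)
      ≡⟨ sum-cong-≗ (λ i → trans (sum-cong-≗ (λ j → if-+ (adj G i j))) (∑-distrib-+ (from i) (to i))) ⟩
    ∑[ i < n ] (∑[ j < n ] from i j + ∑[ j < n ] to i j)
      ≡⟨ ∑-distrib-+ (λ i → ∑[ j < n ] from i j) (λ i → ∑[ j < n ] to i j) ⟩
    ∑[ i < n ] ∑[ j < n ] from i j + ∑[ i < n ] ∑[ j < n ] to i j
      ≡⟨ cong (∑[ i < n ] ∑[ j < n ] from i j +_) (trans (∑-comm to) (sum-cong-≗ λ j → sum-cong-≗ λ i →
           cong (if_then d j else 0) (Graph.sym G i j))) ⟩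
    ∑[ i < n ] ∑[ j < n ] from i j + ∑[ i < n ] ∑[ j < n ] from i j
      ≡⟨ cong (λ x → x + x) (sum-cong-≗ λ i → trans (∑-if (adj G i) (d i)) (cong (d i *_) (sym (degreeOf-∑ (adj G) i)))) ⟩
    ∑[ i < n ] (d i * d i) + ∑[ i < n ] (d i * d i)
      ≡⟨ cong (∑[ i < n ] (d i * d i) +_) (sym (+-identityʳ _)) ⟩
    2 * ∑[ i < n ] (d i * d i) ∎)
    where
    open ≡-Reasoning
    d : Fin n → ℕ
    d = deg G
    from to : Fin n → Fin n → ℕ
    from i j = if adj G i j then d i else 0
    to   i j = if adj G i j then d j else 0
    if-+ : ∀ {x y} b → (if b then x + y else 0) ≡ (if b then x else 0) + (if b then y else 0)
    if-+ true  = refl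
    if-+ false = refl

degree2-neighbours : ∀ {n} (A : Fin n → Fin n → Bool) {x a b c} → degreeOf A x ≡ 2 → a ≢ b →
                     A x a ≡ true → A x b ≡ true → A x c ≡ true → c ≡ a ⊎ c ≡ b
degree2-neighbours {n} A {x} {a} {b} {c} deg≡2 a≢b xa xb xc with c Finₚ.≟ a | c Finₚ.≟ b
... | yes c≡a | _       = inj₁ c≡a
... | no _    | yes c≡b = inj₂ c≡b
... | no c≢a  | no c≢b  = ⊥-elim (1+n≰n (begin
  3                                                                ≡⟨ cong₂ _+_ (cong₂ _+_ (∑-𝟙-== a) (∑-𝟙-== b)) (∑-𝟙-== c) ⟨
  ∑[ j < n ] 𝟙 (j == a) + ∑[ j < n ] 𝟙 (j == b) + ∑[ j < n ] 𝟙 (j == c)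
    ≡⟨ cong (_+ ∑[ j < n ] 𝟙 (j == c)) (∑-distrib-+ (λ j → 𝟙 (j == a)) (λ j → 𝟙 (j == b))) ⟨
  ∑[ j < n ] (𝟙 (j == a) + 𝟙 (j == b)) + ∑[ j < n ] 𝟙 (j == c)
    ≡⟨ ∑-distrib-+ (λ j → 𝟙 (j == a) + 𝟙 (j == b)) (λ j → 𝟙 (j == c)) ⟨
  ∑[ j < n ] (𝟙 (j == a) + 𝟙 (j == b) + 𝟙 (j == c))                ≤⟨ ∑-mono-≤ at-most-adjacent ⟩
  ∑[ j < n ] 𝟙 (A x j)                                             ≡⟨ degreeOf-∑ A x ⟨
  degreeOf A x                                                     ≡⟨ deg≡2 ⟩
  2                                                                ∎))
  where
  open ≤-Reasoning
  adjacent : ∀ j {y} → A x y ≡ true → (j == y) ≡ true → A x j ≡ true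
  adjacent j {y} xy j==y = subst (λ k → A x k ≡ true) (sym (==⇒≡ j y j==y)) xy
  distinct : ∀ j {y z} → y ≢ z → (j == y) ≡ true → (j == z) ≡ true → ⊥
  distinct j {y} {z} y≢z j==y j==z = y≢z (trans (sym (==⇒≡ j y j==y)) (==⇒≡ j z j==z))
  at-most-adjacent : ∀ j → 𝟙 (j == a) + 𝟙 (j == b) + 𝟙 (j == c) ≤ 𝟙 (A x j)
  at-most-adjacent j = 𝟙-exclusive-≤ {j == a} {j == b} {j == c}
    (adjacent j xa) (adjacent j xb) (adjacent j xc)
    (distinct j a≢b) (distinct j (c≢a ∘ sym)) (distinct j (c≢b ∘ sym))

-- The cycle C_n

cyclicSuc : ∀ {m} → Fin (suc m) → Fin (suc m)
cyclicSuc {m} i with m ℕ.≟ toℕ i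
... | yes _   = Fin.zero
... | no m≢i = Fin.suc (Fin.lower₁ i m≢i)

cyclicPred : ∀ {m} → Fin (suc m) → Fin (suc m)
cyclicPred {m} Fin.zero    = Fin.fromℕ m
cyclicPred     (Fin.suc i) = Fin.inject₁ i

CyclicSucView : ∀ {m} → Fin (suc m) → Set
CyclicSucView {m} i = (toℕ i ≡ m × toℕ (cyclicSuc i) ≡ 0) ⊎ (toℕ i < m × toℕ (cyclicSuc i) ≡ suc (toℕ i))

cyclicSuc-view : ∀ {m} (i : Fin (suc m)) → CyclicSucView i
cyclicSuc-view {m} i with m ℕ.≟ toℕ i
... | yes m≡i = inj₁ (sym m≡i , refl)
... | no m≢i = inj₂ (≤∧≢⇒< (Finₚ.toℕ≤pred[n] i) (m≢i ∘ sym) , cong suc (Finₚ.toℕ-lower₁ i m≢i))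

toℕ-cyclicSuc : ∀ {m} (i : Fin (suc m)) → toℕ (cyclicSuc i) ≡ succMod i
toℕ-cyclicSuc {m} i with cyclicSuc-view i
... | inj₁ (i≡m , eq) = trans eq (sym (trans (cong (λ x → suc x % suc m) i≡m) (n%n≡0 (suc m))))
... | inj₂ (i<m , eq) = trans eq (sym (m<n⇒m%n≡m (s≤s i<m)))

cyclicSuc≢id : ∀ {m} → 1 ≤ m → (i : Fin (suc m)) → cyclicSuc i ≢ i
cyclicSuc≢id 1≤m i eq with cyclicSuc-view i
... | inj₁ (i≡m , eq′) = <⇒≢ 1≤m (trans (sym eq′) (trans (cong toℕ eq) i≡m))
... | inj₂ (_ , eq′)   = 1+n≢n (trans (sym eq′) (cong toℕ eq))

cyclicSuc²≢id : ∀ {m} → 2 ≤ m → (i : Fin (suc m)) → cyclicSuc (cyclicSuc i) ≢ i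
cyclicSuc²≢id 2≤m i eq with cyclicSuc-view i | cyclicSuc-view (cyclicSuc i)
... | inj₁ (_ , c≡0)   | inj₁ (c≡m , _)     = <⇒≢ (≤-trans z<s 2≤m) (trans (sym c≡0) c≡m)
... | inj₁ (i≡m , c≡0) | inj₂ (_ , cc≡1+c)  =
  <⇒≢ 2≤m (trans (cong suc (sym c≡0)) (trans (sym cc≡1+c) (trans (cong toℕ eq) i≡m)))
... | inj₂ (_ , c≡1+i) | inj₁ (c≡m , cc≡0)  =
  <⇒≢ 2≤m (trans (cong suc (sym (trans (sym (cong toℕ eq)) cc≡0))) (trans (sym c≡1+i) c≡m))
... | inj₂ (_ , c≡1+i) | inj₂ (_ , cc≡1+c)  =
  <⇒≢ (s≤s (n≤1+n _)) (trans (sym (cong toℕ eq)) (trans cc≡1+c (cong suc c≡1+i)))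

cyclicSuc-cyclicPred : ∀ {m} (i : Fin (suc m)) → cyclicSuc (cyclicPred i) ≡ i
cyclicSuc-cyclicPred {m} Fin.zero with cyclicSuc-view (Fin.fromℕ m)
... | inj₁ (_ , c≡0)  = Finₚ.toℕ-injective c≡0
... | inj₂ (m<m , _) = ⊥-elim (<-irrefl (Finₚ.toℕ-fromℕ m) m<m)
cyclicSuc-cyclicPred {suc m} (Fin.suc i) with cyclicSuc-view (Fin.inject₁ i)
... | inj₁ (i≡m , _)   = ⊥-elim (<⇒≢ (Finₚ.toℕ<n i) (trans (sym (Finₚ.toℕ-inject₁ i)) i≡m))
... | inj₂ (_ , c≡1+i) = Finₚ.toℕ-injective (trans c≡1+i (cong suc (Finₚ.toℕ-inject₁ i)))

cyclicSuc-injective : ∀ {m} {i j : Fin (suc m)} → cyclicSuc i ≡ cyclicSuc j → i ≡ j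
cyclicSuc-injective {i = i} {j} eq with cyclicSuc-view i | cyclicSuc-view j
... | inj₁ (i≡m , _)   | inj₁ (j≡m , _)   = Finₚ.toℕ-injective (trans i≡m (sym j≡m))
... | inj₂ (_ , c≡1+i) | inj₂ (_ , c≡1+j) =
  Finₚ.toℕ-injective (suc-injective (trans (sym c≡1+i) (trans (cong toℕ eq) c≡1+j)))
... | inj₁ (_ , c≡0)   | inj₂ (_ , c≡1+j) = ⊥-elim (0≢1+n (trans (sym c≡0) (trans (cong toℕ eq) c≡1+j)))
... | inj₂ (_ , c≡1+i) | inj₁ (_ , c≡0)   = ⊥-elim (0≢1+n (trans (sym c≡0) (trans (cong toℕ (sym eq)) c≡1+i)))

==-cyclicSuc : ∀ {m} (i j : Fin (suc m)) → (i == cyclicSuc j) ≡ (j == cyclicPred i)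
==-cyclicSuc i j with j Finₚ.≟ cyclicPred i
... | yes refl = trans (cong (i ==_) (cyclicSuc-cyclicPred i)) (trans (==-refl i) (sym (==-refl j)))
... | no j≢i⁻ = trans (≢⇒==-false λ i≡j⁺ →
        j≢i⁻ (cyclicSuc-injective (trans (sym i≡j⁺) (sym (cyclicSuc-cyclicPred i)))))
      (sym (≢⇒==-false j≢i⁻))

cycleAdj-cyclicSuc : ∀ {m} → 1 ≤ m → (i j : Fin (suc m)) →
                     cycleAdj i j ≡ (j == cyclicSuc i) ∨ (i == cyclicSuc j)
cycleAdj-cyclicSuc 1≤m i j
  rewrite sym (toℕ-cyclicSuc i) | sym (toℕ-cyclicSuc j)
        | ≡ᵇ-toℕ i j | ≡ᵇ-toℕ j (cyclicSuc i) | ≡ᵇ-toℕ i (cyclicSuc j) with i Finₚ.≟ j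
... | no i≢j rewrite ≢⇒==-false i≢j = refl
... | yes refl rewrite ==-refl i | ≢⇒==-false (cyclicSuc≢id 1≤m i ∘ sym) = refl

cycleGraph-2-regular : ∀ {n} → 3 ≤ n → ∀ i → deg (cycleGraph n) i ≡ 2
cycleGraph-2-regular {suc m} (s≤s 2≤m) i = begin
  deg (cycleGraph (suc m)) i
    ≡⟨ degreeOf-∑ cycleAdj i ⟩
  ∑[ j < suc m ] 𝟙 (cycleAdj i j)
    ≡⟨ sum-cong-≗ neighbours ⟩
  ∑[ j < suc m ] (𝟙 (j == cyclicSuc i) + 𝟙 (j == cyclicPred i))
    ≡⟨ ∑-distrib-+ (λ j → 𝟙 (j == cyclicSuc i)) (λ j → 𝟙 (j == cyclicPred i)) ⟩
  ∑[ j < suc m ] 𝟙 (j == cyclicSuc i) + ∑[ j < suc m ] 𝟙 (j == cyclicPred i)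
    ≡⟨ cong₂ _+_ (∑-𝟙-== (cyclicSuc i)) (∑-𝟙-== (cyclicPred i)) ⟩
  2 ∎
  where
  open ≡-Reasoning
  disjoint : ∀ j → (j == cyclicSuc i) ≡ true → (j == cyclicPred i) ≡ true → ⊥
  disjoint j j≡i⁺ j≡i⁻ = cyclicSuc²≢id 2≤m i (begin
    cyclicSuc (cyclicSuc i)  ≡⟨ cong cyclicSuc (==⇒≡ j (cyclicSuc i) j≡i⁺) ⟨
    cyclicSuc j              ≡⟨ cong cyclicSuc (==⇒≡ j (cyclicPred i) j≡i⁻) ⟩
    cyclicSuc (cyclicPred i) ≡⟨ cyclicSuc-cyclicPred i ⟩
    i                        ∎)
  𝟙-∨ : ∀ x y → (x ≡ true → y ≡ true → ⊥) → 𝟙 (x ∨ y) ≡ 𝟙 x + 𝟙 y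
  𝟙-∨ true  true  both = ⊥-elim (both refl refl)
  𝟙-∨ true  false _    = refl
  𝟙-∨ false _     _    = refl
  neighbours : ∀ j → 𝟙 (cycleAdj i j) ≡ 𝟙 (j == cyclicSuc i) + 𝟙 (j == cyclicPred i)
  neighbours j rewrite cycleAdj-cyclicSuc (≤-trans (s≤s z≤n) 2≤m) i j | ==-cyclicSuc i j =
    𝟙-∨ (j == cyclicSuc i) (j == cyclicPred i) (disjoint j)

-- Connected graphs containing a cycle

module _ {n} {G : Graph n} {S : Fin n → Fin n → Bool} (cycle : IsCycle G S) where

  open IsCycle cycle using (sub; deg02; nonempty)

  cycle-incident⇒deg2 : ∀ {i j} → S i j ≡ true → degreeOf S i ≡ 2
  cycle-incident⇒deg2 {i} {j} Sij with deg02 i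
  ... | inj₂ deg≡2 = deg≡2
  ... | inj₁ deg≡0 = ⊥-elim (1+n≰n (begin
    1                           ≡⟨ cong 𝟙 Sij ⟨
    𝟙 (S i j)                   ≤⟨ term≤∑ (𝟙 ∘ S i) j ⟩
    ∑[ k < n ] 𝟙 (S i k)        ≡⟨ degreeOf-∑ S i ⟨
    degreeOf S i                ≡⟨ deg≡0 ⟩
    0                           ∎))
    where open ≤-Reasoning

  cycle⇒3≤n : 3 ≤ n
  cycle⇒3≤n with nonempty
  ... | i , j , Sij with ∑-𝟙-two-witnesses (S i) (≤-reflexive (trans (sym (cycle-incident⇒deg2 Sij)) (degreeOf-∑ S i)))
  ...   | a , b , a≢b , Sia , Sib = three-distinct⇒3≤n (adj⇒≢ G (sub i a Sia)) (adj⇒≢ G (sub i b Sib)) a≢b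

module Distance {n} (G : Graph n) (root : Fin n → Bool) where

  within : ℕ → Fin n → Bool
  within zero    v = root v
  within (suc k) v = within k v ∨ anyFin (λ u → adj G v u ∧ within k u)

  walk⇒within : ∀ {v c} → Walk (adj G) v c → root c ≡ true → ∃[ k ] within k v ≡ true
  walk⇒within here               root-c = 0 , root-c
  walk⇒within (step {v} {u} vu w) root-c with walk⇒within w root-c
  ... | k , within-u =
    suc k , ∨-introʳ (within k v) (anyFin-intro (λ u → adj G v u ∧ within k u) (cong₂ _∧_ vu within-u))

  module _ (reachable : ∀ v → ∃[ k ] within k v ≡ true) where

    private
      least : ∀ v → ∃[ m ] within m v ≡ true × (∀ {j} → within j v ≡ true → m ≤ j)
      least v = least-true (λ k → within k v) {proj₁ (reachable v)} (proj₂ (reachable v))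

    dist : Fin n → ℕ
    dist v = proj₁ (least v)

    closer-neighbour : ∀ v → root v ≡ false → ∃[ u ] adj G v u ≡ true × dist u < dist v
    closer-neighbour v not-root with least v
    ... | zero  , within-v , _ with () ← trans (sym not-root) within-v
    ... | suc k , within-v , minimal with within k v in within-k
    ...   | true  = ⊥-elim (1+n≰n (minimal within-k))
    ...   | false with anyFin-witness _ within-v
    ...     | u , vu∧within-u with ∧-true (adj G v u) vu∧within-u
    ...       | vu , within-u = u , vu , s≤s (proj₂ (proj₂ (least u)) within-u)

    private
      parent-choice : ∀ v → ∃[ u ] (root v ≡ false → adj G v u ≡ true × dist u < dist v)
      parent-choice v = choose (root v) refl
        where
        choose : ∀ b → root v ≡ b → ∃[ u ] (root v ≡ false → adj G v u ≡ true × dist u < dist v)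
        choose true  is-root  = v , λ not-root → ⊥-elim (case trans (sym not-root) is-root of λ ())
        choose false not-root = let u , closer = closer-neighbour v not-root in u , λ _ → closer

    parent : Fin n → Fin n
    parent v = proj₁ (parent-choice v)

    parent-adjacent-closer : ∀ v → root v ≡ false → adj G v (parent v) ≡ true × dist (parent v) < dist v
    parent-adjacent-closer v = proj₂ (parent-choice v)

module _ {n} {G : Graph n} {S : Fin n → Fin n → Bool} (cycle : IsCycle G S) (connected : Connected G) where

  private
    open IsCycle cycle using (nonempty; symS; sub)

    onCycle : Fin n → Bool
    onCycle v = degreeOf S v ≡ᵇ 2

    incident-onCycle : ∀ {i j} → S i j ≡ true → onCycle i ≡ true
    incident-onCycle Sij = cong (_≡ᵇ 2) (cycle-incident⇒deg2 cycle Sij)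

    open Distance G onCycle

    reachable : ∀ v → ∃[ k ] within k v ≡ true
    reachable v with nonempty
    ... | c , _ , Scd = walk⇒within (connected v c) (incident-onCycle Scd)

    p : Fin n → Fin n
    p = parent reachable

    d : Fin n → ℕ
    d = dist reachable

    cycleEdge toParent : Fin n → Fin n → Bool
    cycleEdge v j = onCycle v ∧ S v j
    toParent  v j = not (onCycle v) ∧ (j == p v)

    cycleEdge⇒onCycle : ∀ v j → cycleEdge v j ≡ true → onCycle v ≡ true × onCycle j ≡ true
    cycleEdge⇒onCycle v j e = let on-v , Svj = ∧-true (onCycle v) e in
      on-v , incident-onCycle (trans (symS j v) Svj)

    toParent⇒offCycle : ∀ v j → toParent v j ≡ true → onCycle v ≡ false
    toParent⇒offCycle v j e = not-injective (proj₁ (∧-true (not (onCycle v)) e))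

    toParent⇒adj-closer : ∀ v j → toParent v j ≡ true → adj G v j ≡ true × d j < d v
    toParent⇒adj-closer v j e with ==⇒≡ j (p v) (proj₂ (∧-true (not (onCycle v)) e))
    ... | refl = parent-adjacent-closer reachable v (toParent⇒offCycle v j e)

    parent-edges : ∀ v → ∑[ j < n ] 𝟙 (toParent v j) ≡ 𝟙 (not (onCycle v))
    parent-edges v = by-cases (onCycle v)
      where
      by-cases : ∀ b → ∑[ j < n ] 𝟙 (not b ∧ (j == p v)) ≡ 𝟙 (not b)
      by-cases true  = sum-replicate-zero n
      by-cases false = ∑-𝟙-== (p v)

    cycle-edges : ∀ v → ∑[ j < n ] 𝟙 (cycleEdge v j) ≡ 2 * 𝟙 (onCycle v)
    cycle-edges v with onCycle v in on
    ... | true  = trans (sym (degreeOf-∑ S v)) (≡ᵇ⇒≡ _ 2 (subst T (sym on) _))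
    ... | false = sum-replicate-zero n

    edge-kinds-exclusive : ∀ v j → 𝟙 (cycleEdge v j) + 𝟙 (toParent v j) + 𝟙 (toParent j v) ≤ 𝟙 (adj G v j)
    edge-kinds-exclusive v j = 𝟙-exclusive-≤
      (λ e → sub v j (proj₂ (∧-true (onCycle v) e)))
      (λ e → proj₁ (toParent⇒adj-closer v j e))
      (λ e → adj-sym G (proj₁ (toParent⇒adj-closer j v e)))
      (λ e e′ → true≢false (trans (sym (proj₁ (cycleEdge⇒onCycle v j e))) (toParent⇒offCycle v j e′)))
      (λ e e′ → true≢false (trans (sym (proj₂ (cycleEdge⇒onCycle v j e))) (toParent⇒offCycle j v e′)))
      (λ e e′ → <-asym (proj₂ (toParent⇒adj-closer v j e)) (proj₂ (toParent⇒adj-closer j v e′)))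
      where
      true≢false : true ≡ false → ⊥
      true≢false ()

  -- At v, its cycle edges, the edge to its parent and the edges from its
  -- children are pairwise distinct, as parents are strictly closer to the cycle.
  2n≤∑deg : n * 2 ≤ ∑[ v < n ] deg G v
  2n≤∑deg = begin
    n * 2
      ≡⟨ ∑-const n 2 ⟨
    ∑[ v < n ] 2
      ≡⟨ sum-cong-≗ (λ v → split-2 (onCycle v)) ⟨
    ∑[ v < n ] (2 * 𝟙 (onCycle v) + 𝟙 (not (onCycle v)) + 𝟙 (not (onCycle v)))
      ≡⟨ ∑-distrib-+ (λ v → 2 * 𝟙 (onCycle v) + 𝟙 (not (onCycle v))) (λ v → 𝟙 (not (onCycle v))) ⟩
    ∑[ v < n ] (2 * 𝟙 (onCycle v) + 𝟙 (not (onCycle v))) + ∑[ v < n ] 𝟙 (not (onCycle v))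
      ≡⟨ cong₂ _+_ (sum-cong-≗ λ v → cong₂ _+_ (cycle-edges v) (parent-edges v)) (sum-cong-≗ parent-edges) ⟨
    ∑[ v < n ] (∑[ j < n ] 𝟙 (cycleEdge v j) + ∑[ j < n ] 𝟙 (toParent v j)) + ∑[ j < n ] ∑[ v < n ] 𝟙 (toParent j v)
      ≡⟨ cong (∑[ v < n ] (∑[ j < n ] 𝟙 (cycleEdge v j) + ∑[ j < n ] 𝟙 (toParent v j)) +_)
              (∑-comm (λ j v → 𝟙 (toParent j v))) ⟩
    ∑[ v < n ] (∑[ j < n ] 𝟙 (cycleEdge v j) + ∑[ j < n ] 𝟙 (toParent v j)) + ∑[ v < n ] ∑[ j < n ] 𝟙 (toParent j v)
      ≡⟨ ∑-distrib-+ (λ v → ∑[ j < n ] 𝟙 (cycleEdge v j) + ∑[ j < n ] 𝟙 (toParent v j))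
                     (λ v → ∑[ j < n ] 𝟙 (toParent j v)) ⟨
    ∑[ v < n ] (∑[ j < n ] 𝟙 (cycleEdge v j) + ∑[ j < n ] 𝟙 (toParent v j) + ∑[ j < n ] 𝟙 (toParent j v))
      ≡⟨ sum-cong-≗ (λ v → ∑-distrib-+₃ (λ j → 𝟙 (cycleEdge v j)) (λ j → 𝟙 (toParent v j)) (λ j → 𝟙 (toParent j v))) ⟨
    ∑[ v < n ] ∑[ j < n ] (𝟙 (cycleEdge v j) + 𝟙 (toParent v j) + 𝟙 (toParent j v))
      ≤⟨ ∑-mono-≤ (λ v → ∑-mono-≤ (edge-kinds-exclusive v)) ⟩
    ∑[ v < n ] ∑[ j < n ] 𝟙 (adj G v j)
      ≡⟨ sum-cong-≗ (degreeOf-∑ (adj G)) ⟨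
    ∑[ v < n ] deg G v ∎
    where
    open ≤-Reasoning
    split-2 : ∀ b → 2 * 𝟙 b + 𝟙 (not b) + 𝟙 (not b) ≡ 2
    split-2 true  = refl
    split-2 false = refl

-- Connected 2-regular graphs

-- The non-backtracking walk from vertex 0 is forced by 2-regularity; its first
-- repeated vertex is its start, and by connectivity the closed walk visits every
-- vertex, which makes k ↦ walk k an isomorphism from C_n.
module TwoRegular {m} (G : Graph (suc m)) (regular : ∀ v → deg G v ≡ 2) (connected : Connected G) where

  private
    n : ℕ
    n = suc m

    A : Fin n → Fin n → Bool
    A = adj G

  private
    two-neighbours : ∀ v → ∃[ a ] ∃[ b ] a ≢ b × A v a ≡ true × A v b ≡ true
    two-neighbours v = ∑-𝟙-two-witnesses (A v) (≤-reflexive (trans (sym (regular v)) (degreeOf-∑ A v)))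

    first second : Fin n → Fin n
    first  v = proj₁ (two-neighbours v)
    second v = proj₁ (proj₂ (two-neighbours v))

    first≢second : ∀ v → first v ≢ second v
    first≢second v = proj₁ (proj₂ (proj₂ (two-neighbours v)))

    first-adj : ∀ v → A v (first v) ≡ true
    first-adj  v = proj₁ (proj₂ (proj₂ (proj₂ (two-neighbours v))))
    second-adj : ∀ v → A v (second v) ≡ true
    second-adj v = proj₂ (proj₂ (proj₂ (proj₂ (two-neighbours v))))

  other : Fin n → Fin n → Fin n
  other x y = if x == first y then second y else first y

  other-adj : ∀ x y → A y (other x y) ≡ true
  other-adj x y with x == first y
  ... | true  = second-adj y
  ... | false = first-adj y

  other≢ : ∀ x y → other x y ≢ x
  other≢ x y with x == first y in x==first
  ... | true  = λ second≡x → first≢second y (trans (sym (==⇒≡ x (first y) x==first)) (sym second≡x))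
  ... | false = λ first≡x → case trans (sym x==first) (subst (λ z → (x == z) ≡ true) (sym first≡x) (==-refl x)) of λ ()

  neighbour-cases : ∀ {x y c} → A y x ≡ true → A y c ≡ true → c ≡ x ⊎ c ≡ other x y
  neighbour-cases {x} {y} yx yc =
    degree2-neighbours A (regular y) (λ x≡other → other≢ x y (sym x≡other)) yx (other-adj x y) yc

  private
    steps : ℕ → Fin n × Fin n
    steps zero    = Fin.zero , first Fin.zero
    steps (suc k) = proj₂ (steps k) , other (proj₁ (steps k)) (proj₂ (steps k))

  walk : ℕ → Fin n
  walk k = proj₁ (steps k)

  walk-adj : ∀ k → A (walk k) (walk (suc k)) ≡ true
  walk-adj zero    = first-adj Fin.zero
  walk-adj (suc k) = other-adj (walk k) (walk (suc k))

  walk-no-backtrack : ∀ k → walk (suc (suc k)) ≢ walk k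
  walk-no-backtrack k = other≢ (walk k) (walk (suc k))

  walk-neighbours : ∀ k {c} → A (walk (suc k)) c ≡ true → c ≡ walk k ⊎ c ≡ walk (suc (suc k))
  walk-neighbours k = neighbour-cases (adj-sym G (walk-adj k))

  open FirstRepeat (first-repeat walk)

  starts-at-0 : i ≡ 0
  starts-at-0 = go i j i<j repeat injective-below
    where
    go : ∀ i j → i < j → walk i ≡ walk j → (∀ {a b} → a < b → b < j → walk a ≢ walk b) → i ≡ 0
    go zero    _       _   _      _         = refl
    go (suc i) (suc j) i<j repeat injective with walk-neighbours i (subst (λ x → A x (walk j) ≡ true) (sym repeat) (adj-sym G (walk-adj j)))
    ... | inj₁ j≡i   = ⊥-elim (injective (ℕ.s≤s⁻¹ i<j) ≤-refl (sym j≡i))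
    ... | inj₂ j≡i+2 with <-cmp (suc (suc i)) j
    ...   | tri< i+2<j _ _ = ⊥-elim (injective i+2<j ≤-refl (sym j≡i+2))
    ...   | tri≈ _ refl _  = ⊥-elim (walk-no-backtrack (suc i) (sym repeat))
    ...   | tri> _ _ j<i+2 with ≤-antisym (ℕ.s≤s⁻¹ j<i+2) (ℕ.s≤s⁻¹ i<j)
    ...     | refl = ⊥-elim (adj⇒≢ G (walk-adj (suc i)) repeat)

  closes : walk j ≡ walk 0
  closes = trans (sym repeat) (cong walk starts-at-0)

  3≤j : 3 ≤ j
  3≤j = go j i<j closes
    where
    go : ∀ j → i < j → walk j ≡ walk 0 → 3 ≤ j
    go 1                   _ closed = ⊥-elim (adj⇒≢ G (walk-adj 0) (sym closed))
    go 2                   _ closed = ⊥-elim (walk-no-backtrack 0 closed)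
    go (suc (suc (suc _))) _ _      = s≤s (s≤s (s≤s z≤n))

  private
    last : ℕ
    last = ℕ.pred j

    1+last≡j : suc last ≡ j
    1+last≡j = suc-pred j {{ℕ.>-nonZero (≤-trans (s≤s z≤n) 3≤j)}}

    last<j : last < j
    last<j = ≤-reflexive 1+last≡j

  walk-neighbours-0 : ∀ {c} → A (walk 0) c ≡ true → c ≡ walk 1 ⊎ c ≡ walk last
  walk-neighbours-0 = degree2-neighbours A (regular (walk 0))
    (injective-below (ℕ.s≤s⁻¹ (≤-trans 3≤j (≤-reflexive (sym 1+last≡j)))) last<j)
    (walk-adj 0)
    (subst (λ x → A x (walk last) ≡ true) (trans (cong walk 1+last≡j) closes) (adj-sym G (walk-adj last)))

  visited : ∀ v → ∃[ k ] k < j × walk k ≡ v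
  visited v = along (connected (walk 0) v) 0 (≤-trans (s≤s z≤n) 3≤j) refl
    where
    along : ∀ {x y} → Walk A x y → ∀ k → k < j → walk k ≡ x → ∃[ k ] k < j × walk k ≡ y
    along here k k<j refl = k , k<j , refl
    along (step xy rest) zero _ refl with walk-neighbours-0 xy
    ... | inj₁ y≡w1    = along rest 1 (≤-trans (s≤s (s≤s z≤n)) 3≤j) (sym y≡w1)
    ... | inj₂ y≡wlast = along rest last last<j (sym y≡wlast)
    along (step xy rest) (suc k) k<j refl with walk-neighbours k xy
    ... | inj₁ y≡wk   = along rest k (≤-trans (n≤1+n (suc k)) k<j) (sym y≡wk)
    ... | inj₂ y≡wk+2 with suc (suc k) ℕ.<? j
    ...   | yes k+2<j = along rest (suc (suc k)) k+2<j (sym y≡wk+2)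
    ...   | no  k+2≮j = along rest 0 (≤-trans (s≤s z≤n) k<j)
            (sym (trans y≡wk+2 (trans (cong walk (≤-antisym k<j (≮⇒≥ k+2≮j))) closes)))

  private
    visit-index : Fin n → Fin j
    visit-index v = Fin.fromℕ< (proj₁ (proj₂ (visited v)))

    walk-visit-index : ∀ v → walk (toℕ (visit-index v)) ≡ v
    walk-visit-index v = trans (cong walk (Finₚ.toℕ-fromℕ< (proj₁ (proj₂ (visited v))))) (proj₂ (proj₂ (visited v)))

  j≡n : j ≡ n
  j≡n with j ℕ.<? n
  ... | no j≮n = ≤-antisym j≤n (≮⇒≥ j≮n)
  ... | yes j<n with Finₚ.pigeonhole j<n visit-index
  ...   | u , v , u<v , same-index = ⊥-elim (<⇒≢ u<v (cong toℕ
    (trans (sym (walk-visit-index u)) (trans (cong (walk ∘ toℕ) same-index) (walk-visit-index v)))))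

  position : Fin n → Fin n
  position k = walk (toℕ k)

  position-injective : ∀ a b → position a ≡ position b → a ≡ b
  position-injective a b eq with <-cmp (toℕ a) (toℕ b)
  ... | tri< a<b _ _ = ⊥-elim (injective-below a<b (subst (toℕ b <_) (sym j≡n) (Finₚ.toℕ<n b)) eq)
  ... | tri≈ _ a≡b _ = Finₚ.toℕ-injective a≡b
  ... | tri> _ _ b<a = ⊥-elim (injective-below b<a (subst (toℕ a <_) (sym j≡n) (Finₚ.toℕ<n a)) (sym eq))

  index : Fin n → Fin n
  index v = Fin.cast j≡n (visit-index v)

  position-index : ∀ v → position (index v) ≡ v
  position-index v = trans (cong walk (Finₚ.toℕ-cast j≡n (visit-index v))) (walk-visit-index v)

  index-position : ∀ a → index (position a) ≡ a
  index-position a = position-injective (index (position a)) a (position-index (position a))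

  position-cyclicSuc : ∀ a → position (cyclicSuc a) ≡ walk (suc (toℕ a))
  position-cyclicSuc a with cyclicSuc-view a
  ... | inj₁ (a≡m , c≡0)  = trans (cong walk c≡0) (trans (sym closes) (cong walk (trans j≡n (cong suc (sym a≡m)))))
  ... | inj₂ (_ , c≡1+a) = cong walk c≡1+a

  position-neighbours : ∀ a {c} → A (position a) c ≡ true → c ≡ position (cyclicSuc a) ⊎ c ≡ position (cyclicPred a)
  position-neighbours Fin.zero xc with walk-neighbours-0 xc
  ... | inj₁ c≡w1    = inj₁ (trans c≡w1 (sym (position-cyclicSuc Fin.zero)))
  ... | inj₂ c≡wlast = inj₂ (trans c≡wlast (cong walk (trans (cong ℕ.pred j≡n) (sym (Finₚ.toℕ-fromℕ m)))))
  position-neighbours (Fin.suc a) xc with walk-neighbours (toℕ a) xc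
  ... | inj₁ c≡wa   = inj₂ (trans c≡wa (cong walk (sym (Finₚ.toℕ-inject₁ a))))
  ... | inj₂ c≡wa+2 = inj₁ (trans c≡wa+2 (sym (position-cyclicSuc (Fin.suc a))))

  private
    1≤m : 1 ≤ m
    1≤m = ℕ.s≤s⁻¹ (≤-trans (s≤s (s≤s z≤n)) (≤-trans 3≤j (≤-reflexive j≡n)))

  position-adj : ∀ a b → A (position a) (position b) ≡ cycleAdj a b
  position-adj a b rewrite cycleAdj-cyclicSuc 1≤m a b = ⇔→≡ {z = true} (mk⇔ to from)
    where
    to : A (position a) (position b) ≡ true → ((b == cyclicSuc a) ∨ (a == cyclicSuc b)) ≡ true
    to ab with position-neighbours a ab
    ... | inj₁ b≡a⁺ = cong (_∨ (a == cyclicSuc b))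
      (subst (λ x → (x == cyclicSuc a) ≡ true) (sym (position-injective b (cyclicSuc a) b≡a⁺)) (==-refl (cyclicSuc a)))
    ... | inj₂ b≡a⁻ = ∨-introʳ (b == cyclicSuc a)
      (subst (λ x → (a == cyclicSuc x) ≡ true) (sym (position-injective b (cyclicPred a) b≡a⁻))
        (subst (λ y → (a == y) ≡ true) (sym (cyclicSuc-cyclicPred a)) (==-refl a)))
    from : ((b == cyclicSuc a) ∨ (a == cyclicSuc b)) ≡ true → A (position a) (position b) ≡ true
    from b==a⁺∨a==b⁺ with b == cyclicSuc a in b==a⁺
    ... | true  rewrite ==⇒≡ b (cyclicSuc a) b==a⁺ | position-cyclicSuc a = walk-adj (toℕ a)
    ... | false rewrite ==⇒≡ a (cyclicSuc b) b==a⁺∨a==b⁺ | position-cyclicSuc b = adj-sym G (walk-adj (toℕ b))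

  isomorphic : Isomorphic G (cycleGraph n)
  isomorphic = permutation index position index-position position-index , λ u v →
    trans (sym (cong₂ A (position-index u) (position-index v))) (position-adj (index u) (index v))

not-2-regular : ∀ {m} (G : Graph (suc m)) → Connected G → ¬ Isomorphic G (cycleGraph (suc m)) → ∃[ v ] deg G v ≢ 2
not-2-regular {m} G connected not-cycle with Finₚ.all? (λ v → deg G v ℕ.≟ 2)
... | yes regular   = ⊥-elim (not-cycle (TwoRegular.isomorphic G regular connected))
... | no  irregular = Finₚ.¬∀⟶∃¬ (suc m) (λ v → deg G v ≡ 2) (λ v → deg G v ℕ.≟ 2) irregular

o≡m+n⇒m≤o : ∀ {m n o} → o ≡ m + n → m ≤ o
o≡m+n⇒m≤o {m} {n} refl = m≤m+n m n

4d≤d²+4 : ∀ d → 4 * d ≤ d * d + 4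
4d≤d²+4 0             = z≤n
4d≤d²+4 1             = s≤s (s≤s (s≤s (s≤s z≤n)))
4d≤d²+4 (suc (suc e)) = o≡m+n⇒m≤o (solve 1 (λ e → (con 2 :+ e) :* (con 2 :+ e) :+ con 4
                                              := con 4 :* (con 2 :+ e) :+ e :* e) refl e)
  where open +-*-Solver

4d<d²+4 : ∀ d → d ≢ 2 → 4 * d < d * d + 4
4d<d²+4 0                   _   = s≤s z≤n
4d<d²+4 1                   _   = ≤-refl
4d<d²+4 2                   2≢2 = ⊥-elim (2≢2 refl)
4d<d²+4 (suc (suc (suc e))) _   = o≡m+n⇒m≤o (solve 1 (λ e → (con 3 :+ e) :* (con 3 :+ e) :+ con 4
                                                    := con 1 :+ con 4 :* (con 3 :+ e) :+ (e :* e :+ con 2 :* e)) refl e)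
  where open +-*-Solver

private
  [a+b]²≤2[a²+b²]-ordered : ∀ {a b} → a ≤ b → (a + b) * (a + b) ≤ 2 * (a * a + b * b)
  [a+b]²≤2[a²+b²]-ordered {a} a≤b with m≤n⇒∃[o]m+o≡n a≤b
  ... | t , refl = o≡m+n⇒m≤o (solve 2 (λ a t → con 2 :* (a :* a :+ (a :+ t) :* (a :+ t))
                                         := (a :+ (a :+ t)) :* (a :+ (a :+ t)) :+ t :* t) refl a t)
    where open +-*-Solver

[a+b]²≤2[a²+b²] : ∀ a b → (a + b) * (a + b) ≤ 2 * (a * a + b * b)
[a+b]²≤2[a²+b²] a b with ≤-total a b
... | inj₁ a≤b = [a+b]²≤2[a²+b²]-ordered a≤b
... | inj₂ b≤a = subst₂ _≤_ (cong (λ x → x * x) (+-comm b a)) (cong (2 *_) (+-comm (b * b) (a * a)))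
                        ([a+b]²≤2[a²+b²]-ordered b≤a)

pell : ∀ t → ∃[ p ] ∃[ q ] p * p ≡ 2 * (q * q) + 1 × t < q
pell zero = 3 , 2 , refl , s≤s z≤n
pell (suc t) with pell t
... | p , q , p²≡2q²+1 , t<q = 3 * p + 4 * q , 2 * p + 3 * q , next-solution , growth
  where
  open +-*-Solver
  next-solution : (3 * p + 4 * q) * (3 * p + 4 * q) ≡ 2 * ((2 * p + 3 * q) * (2 * p + 3 * q)) + 1
  next-solution = begin
    (3 * p + 4 * q) * (3 * p + 4 * q)
      ≡⟨ solve 2 (λ p q → (con 3 :* p :+ con 4 :* q) :* (con 3 :* p :+ con 4 :* q)
                       := con 8 :* (p :* p) :+ con 24 :* (p :* q) :+ con 16 :* (q :* q) :+ p :* p) refl p q ⟩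
    8 * (p * p) + 24 * (p * q) + 16 * (q * q) + p * p
      ≡⟨ cong (8 * (p * p) + 24 * (p * q) + 16 * (q * q) +_) p²≡2q²+1 ⟩
    8 * (p * p) + 24 * (p * q) + 16 * (q * q) + (2 * (q * q) + 1)
      ≡⟨ solve 2 (λ p q → con 8 :* (p :* p) :+ con 24 :* (p :* q) :+ con 16 :* (q :* q) :+ (con 2 :* (q :* q) :+ con 1)
                       := con 2 :* ((con 2 :* p :+ con 3 :* q) :* (con 2 :* p :+ con 3 :* q)) :+ con 1) refl p q ⟩
    2 * ((2 * p + 3 * q) * (2 * p + 3 * q)) + 1 ∎
    where open ≡-Reasoning
  growth : suc t < 2 * p + 3 * q
  growth = ≤-trans (+-mono-≤ (≤-trans (s≤s z≤n) t<q) t<q)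
                   (≤-trans (+-monoʳ-≤ q (m≤m+n q _)) (m≤n+m (3 * q) (2 * p)))

module _ (p q : ℕ) (p²≡2q²+1 : p * p ≡ 2 * (q * q) + 1) where

  private
    2q²≤p² : 2 * (q * q) ≤ p * p
    2q²≤p² = o≡m+n⇒m≤o p²≡2q²+1

  8[pq]²≤[2p²]² : 8 * (p * q) * (p * q) ≤ (2 * (p * p)) * (2 * (p * p))
  8[pq]²≤[2p²]² = begin
    8 * (p * q) * (p * q)          ≡⟨ solve 2 (λ p q → con 8 :* (p :* q) :* (p :* q) := (con 4 :* (p :* p)) :* (con 2 :* (q :* q))) refl p q ⟩
    (4 * (p * p)) * (2 * (q * q))  ≤⟨ *-monoʳ-≤ (4 * (p * p)) 2q²≤p² ⟩
    (4 * (p * p)) * (p * p)        ≡⟨ solve 1 (λ p → (con 4 :* (p :* p)) :* (p :* p) := (con 2 :* (p :* p)) :* (con 2 :* (p :* p))) refl p ⟩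
    (2 * (p * p)) * (2 * (p * p))  ∎
    where
    open ≤-Reasoning
    open +-*-Solver

  [q²[a+b]]²≤[a²+b²][pq]² : ∀ a b → (q * q * (a + b)) * (q * q * (a + b)) ≤ (a * a + b * b) * (p * q) * (p * q)
  [q²[a+b]]²≤[a²+b²][pq]² a b = begin
    (q * q * (a + b)) * (q * q * (a + b))
      ≡⟨ solve 3 (λ q a b → (q :* q :* (a :+ b)) :* (q :* q :* (a :+ b)) := (q :* q) :* ((a :+ b) :* (a :+ b) :* (q :* q))) refl q a b ⟩
    (q * q) * ((a + b) * (a + b) * (q * q))
      ≤⟨ *-monoʳ-≤ (q * q) (*-monoˡ-≤ (q * q) ([a+b]²≤2[a²+b²] a b)) ⟩
    (q * q) * (2 * (a * a + b * b) * (q * q))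
      ≡⟨ solve 3 (λ q a b → (q :* q) :* (con 2 :* (a :* a :+ b :* b) :* (q :* q)) := (q :* q) :* ((a :* a :+ b :* b) :* (con 2 :* (q :* q)))) refl q a b ⟩
    (q * q) * ((a * a + b * b) * (2 * (q * q)))
      ≤⟨ *-monoʳ-≤ (q * q) (*-monoʳ-≤ (a * a + b * b) 2q²≤p²) ⟩
    (q * q) * ((a * a + b * b) * (p * p))
      ≡⟨ solve 4 (λ p q a b → (q :* q) :* ((a :* a :+ b :* b) :* (p :* p)) := (a :* a :+ b :* b) :* (p :* q) :* (p :* q)) refl p q a b ⟩
    (a * a + b * b) * (p * q) * (p * q) ∎
    where
    open ≤-Reasoning
    open +-*-Solver

  n[2p²]<q²M : ∀ n M → 2 * n < q → 4 * n < M → n * (2 * (p * p)) < q * q * M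
  n[2p²]<q²M n M 2n<q 4n<M = begin-strict
    n * (2 * (p * p))            ≡⟨ cong (λ x → n * (2 * x)) p²≡2q²+1 ⟩
    n * (2 * (2 * (q * q) + 1))  ≡⟨ solve 2 (λ n q → n :* (con 2 :* (con 2 :* (q :* q) :+ con 1)) := con 4 :* n :* (q :* q) :+ con 2 :* n) refl n q ⟩
    4 * n * (q * q) + 2 * n      <⟨ +-monoʳ-< (4 * n * (q * q)) (<-≤-trans 2n<q (m≤m*n q q {{ℕ.>-nonZero (≤-<-trans z≤n 2n<q)}})) ⟩
    4 * n * (q * q) + q * q      ≡⟨ solve 2 (λ n q → con 4 :* n :* (q :* q) :+ q :* q := q :* q :* (con 1 :+ con 4 :* n)) refl n q ⟩
    q * q * suc (4 * n)          ≤⟨ *-monoʳ-≤ (q * q) 4n<M ⟩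
    q * q * M                    ∎
    where
    open ≤-Reasoning
    open +-*-Solver

-- Comparing sums of square roots

ℚ[]-mkℚ : ∀ a → ℚ[ a ] ≡ mkℚ (ℤ.+ a) 0 (Coprime.sym (1-coprimeTo a))
ℚ[]-mkℚ a = ℚₚ.normalize-coprime (Coprime.sym (1-coprimeTo a))

ℚ[]-+ : ∀ a b → ℚ[ a + b ] ≡ ℚ[ a ] ℚ.+ ℚ[ b ]
ℚ[]-+ a b rewrite ℚ[]-mkℚ a | ℚ[]-mkℚ b | ℤₚ.*-identityʳ (ℤ.+ a) | ℤₚ.*-identityʳ (ℤ.+ b) = refl

ℚ[]-* : ∀ a b → ℚ[ a * b ] ≡ ℚ[ a ] ℚ.* ℚ[ b ]
ℚ[]-* a b rewrite ℚ[]-mkℚ a | ℚ[]-mkℚ b | sym (ℤₚ.pos-* a b) = refl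

ℚ[]-mono-≤ : ∀ {a b} → a ≤ b → ℚ[ a ] ℚ.≤ ℚ[ b ]
ℚ[]-mono-≤ {a} {b} a≤b rewrite ℚ[]-mkℚ a | ℚ[]-mkℚ b =
  ℚ.*≤* (subst₂ ℤ._≤_ (sym (ℤₚ.*-identityʳ (ℤ.+ a))) (sym (ℤₚ.*-identityʳ (ℤ.+ b))) (ℤ.+≤+ a≤b))

ℚ[]-mono-< : ∀ {a b} → a < b → ℚ[ a ] ℚ.< ℚ[ b ]
ℚ[]-mono-< {a} {b} a<b rewrite ℚ[]-mkℚ a | ℚ[]-mkℚ b =
  ℚ.*<* (subst₂ ℤ._<_ (sym (ℤₚ.*-identityʳ (ℤ.+ a))) (sym (ℤₚ.*-identityʳ (ℤ.+ b))) (ℤ.+<+ a<b))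

module _ (k : ℕ) where

  private
    K : ℕ
    K = suc k

    Kℚ : ℚ
    Kℚ = mkℚ (ℤ.+ K) 0 (Coprime.sym (1-coprimeTo K))

    κ : ℚ
    κ = 1/ Kℚ

    _/K : ℕ → ℚ
    a /K = ℚ[ a ] ℚ.* κ

    ℚ[]-cancel : ∀ a → ℚ[ a * K * K ] ℚ.* (κ ℚ.* κ) ≡ ℚ[ a ]
    ℚ[]-cancel a = begin
      ℚ[ a * K * K ] ℚ.* (κ ℚ.* κ)
        ≡⟨ cong (ℚ._* (κ ℚ.* κ)) (trans (ℚ[]-* (a * K) K) (cong₂ ℚ._*_ (ℚ[]-* a K) refl)) ⟩
      ℚ[ a ] ℚ.* ℚ[ K ] ℚ.* ℚ[ K ] ℚ.* (κ ℚ.* κ)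
        ≡⟨ solve 3 (λ x k κ → x :* k :* k :* (κ :* κ) := x :* (k :* κ) :* (k :* κ)) refl ℚ[ a ] ℚ[ K ] κ ⟩
      ℚ[ a ] ℚ.* (ℚ[ K ] ℚ.* κ) ℚ.* (ℚ[ K ] ℚ.* κ)
        ≡⟨ cong (λ x → ℚ[ a ] ℚ.* x ℚ.* x) (trans (cong (ℚ._* κ) (ℚ[]-mkℚ K)) (ℚₚ.*-inverseʳ Kℚ)) ⟩
      ℚ[ a ] ℚ.* 1ℚ ℚ.* 1ℚ
        ≡⟨ trans (ℚₚ.*-identityʳ _) (ℚₚ.*-identityʳ _) ⟩
      ℚ[ a ] ∎
      where
      open ≡-Reasoning
      open ℚ-Solver

    /K-square : ∀ a → (a /K) ℚ.* (a /K) ≡ ℚ[ a * a ] ℚ.* (κ ℚ.* κ)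
    /K-square a = trans (solve 2 (λ x κ → (x :* κ) :* (x :* κ) := (x :* x) :* (κ :* κ)) refl ℚ[ a ] κ)
                        (cong (ℚ._* (κ ℚ.* κ)) (sym (ℚ[]-* a a)))
      where open ℚ-Solver

    /K-mono-≤ : ∀ {a b} → a ≤ b → ℚ[ a ] ℚ.* (κ ℚ.* κ) ℚ.≤ ℚ[ b ] ℚ.* (κ ℚ.* κ)
    /K-mono-≤ a≤b = ℚₚ.*-monoʳ-≤-nonNeg (κ ℚ.* κ) {{ℚₚ.nonNeg*nonNeg⇒nonNeg κ κ}} (ℚ[]-mono-≤ a≤b)

    /K-nonNeg : ∀ a → 0ℚ ℚ.≤ a /K
    /K-nonNeg a = subst (ℚ._≤ a /K) (ℚₚ.*-zeroˡ κ) (ℚₚ.*-monoʳ-≤-nonNeg κ (ℚ[]-mono-≤ {0} {a} z≤n))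

    upper : ∀ a A → a * K * K ≤ A * A → IsUpperSqrt (A /K) a
    upper a A aKK≤AA = /K-nonNeg A , subst₂ ℚ._≤_ (ℚ[]-cancel a) (sym (/K-square A)) (/K-mono-≤ aKK≤AA)

    lower : ∀ b B → B * B ≤ b * K * K → IsLowerSqrt (B /K) b
    lower b B BB≤bKK = /K-nonNeg B , subst₂ ℚ._≤_ (sym (/K-square B)) (ℚ[]-cancel b) (/K-mono-≤ BB≤bKK)

    sumℚ-/K : ∀ {X : Set} (f : X → ℕ) xs → sumℚ (map (λ x → f x /K) xs) ≡ listSum (map f xs) /K
    sumℚ-/K f []       = sym (ℚₚ.*-zeroˡ κ)
    sumℚ-/K f (x ∷ xs) = trans (cong (f x /K ℚ.+_) (sumℚ-/K f xs))
      (trans (sym (ℚₚ.*-distribʳ-+ κ ℚ[ f x ] _)) (cong (ℚ._* κ) (sym (ℚ[]-+ (f x) _))))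

  sqrtSumLt-by-common-denominator :
    ∀ {X Y : Set} (a A : X → ℕ) (b B : Y → ℕ) (xs : List X) (ys : List Y) →
    (∀ x → a x * K * K ≤ A x * A x) → (∀ y → B y * B y ≤ b y * K * K) →
    listSum (map A xs) < listSum (map B ys) → SqrtSumLt (map a xs) (map b ys)
  sqrtSumLt-by-common-denominator a A b B xs ys a≤A² B²≤b ∑A<∑B =
    map (λ x → A x /K) xs , map (λ y → B y /K) ys ,
    Pointwise.map⁺ (λ x → A x /K) a (Pointwise.refl (λ {x} → upper (a x) (A x) (a≤A² x))) ,
    Pointwise.map⁺ (λ y → B y /K) b (Pointwise.refl (λ {y} → lower (b y) (B y) (B²≤b y))) ,
    subst₂ ℚ._<_ (sym (sumℚ-/K A xs)) (sym (sumℚ-/K B ys)) (ℚₚ.*-monoˡ-<-pos κ (ℚ[]-mono-< ∑A<∑B))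

4n<zagreb₁ : ∀ {n} (G : Graph n) → n * 2 ≤ ∑[ v < n ] deg G v → ∃[ v ] deg G v ≢ 2 → 4 * n < zagreb₁ G
4n<zagreb₁ {n} G 2n≤∑deg (v , deg≢2) = +-cancelʳ-< (4 * n) (4 * n) (zagreb₁ G) (begin-strict
  4 * n + 4 * n                         ≡⟨ solve 1 (λ n → con 4 :* n :+ con 4 :* n := con 4 :* (n :* con 2)) refl n ⟩
  4 * (n * 2)                           ≤⟨ *-monoʳ-≤ 4 2n≤∑deg ⟩
  4 * ∑[ u < n ] deg G u                ≡⟨ *-distribˡ-sum 4 (deg G) ⟩
  ∑[ u < n ] (4 * deg G u)              <⟨ ∑-mono-< (λ u → 4d≤d²+4 (deg G u)) v (4d<d²+4 (deg G v) deg≢2) ⟩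
  ∑[ u < n ] (deg G u * deg G u + 4)    ≡⟨ ∑-distrib-+ (λ u → deg G u * deg G u) (λ _ → 4) ⟩
  zagreb₁ G + ∑[ u < n ] 4              ≡⟨ cong (zagreb₁ G +_) (trans (∑-const n 4) (*-comm n 4)) ⟩
  zagreb₁ G + 4 * n                     ∎)
  where
  open ≤-Reasoning
  open +-*-Solver

4n<zagreb₁⇒SO-cycle<SO : ∀ {n} → 3 ≤ n → (G : Graph n) → 4 * n < zagreb₁ G → SOLt (cycleGraph n) G
4n<zagreb₁⇒SO-cycle<SO {n} 3≤n G 4n<M with pell (2 * n)
... | zero     , q      , 0≡2q²+1   , _    = ⊥-elim (0≢1+n (trans 0≡2q²+1 (+-comm (2 * (q * q)) 1)))
-- Over the denominator pq: each term √8 of C_n is at most 2p²/pq = 2p/q, and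
-- each term √(a² + b²) of G is at least q²(a + b)/pq = q(a + b)/p.
... | suc p′   , suc q′ , p²≡2q²+1 , 2n<q =
  sqrtSumLt-by-common-denominator (q′ + p′ * suc q′)
    (soTerm C) (λ _ → 2 * (p * p)) (soTerm G) (λ e → q * q * (deg G (proj₁ e) + deg G (proj₂ e)))
    (edges C) (edges G) upper lower
    (subst₂ _<_ (sym (edgeSum-const-2-regular C C-regular (2 * (p * p))))
                (sym (trans (listSum-map-* (q * q) _ (edges G)) (cong (q * q *_) (edgeSum-deg+deg G))))
                (n[2p²]<q²M p q p²≡2q²+1 n (zagreb₁ G) 2n<q 4n<M))
  where
  p q : ℕ
  p = suc p′
  q = suc q′
  C : Graph n
  C = cycleGraph n
  soTerm : Graph n → Fin n × Fin n → ℕ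
  soTerm H e = deg H (proj₁ e) * deg H (proj₁ e) + deg H (proj₂ e) * deg H (proj₂ e)
  C-regular : ∀ v → deg C v ≡ 2
  C-regular = cycleGraph-2-regular 3≤n
  upper : ∀ e → soTerm C e * (p * q) * (p * q) ≤ 2 * (p * p) * (2 * (p * p))
  upper (u , v) rewrite C-regular u | C-regular v = 8[pq]²≤[2p²]² p q p²≡2q²+1
  lower : ∀ e → q * q * (deg G (proj₁ e) + deg G (proj₂ e)) * (q * q * (deg G (proj₁ e) + deg G (proj₂ e)))
              ≤ soTerm G e * (p * q) * (p * q)
  lower (u , v) = [q²[a+b]]²≤[a²+b²][pq]² p q p²≡2q²+1 (deg G u) (deg G v)

theorem2p4 : (n : ℕ) (G : Graph n) → Unicyclic G
           → ¬ Isomorphic G (cycleGraph n)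
           → SOLt (cycleGraph n) G
theorem2p4 zero    G (_ , (_ , cycle) , _) _ = ⊥-elim (case cycle⇒3≤n cycle of λ ())
theorem2p4 (suc m) G (connected , (_ , cycle) , _) not-cycle =
  4n<zagreb₁⇒SO-cycle<SO (cycle⇒3≤n cycle) G (4n<zagreb₁ G (2n≤∑deg cycle connected) (not-2-regular G connected not-cycle))
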